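{- Every finite tree that is not in $\mathcal T_1$ contains two vertex-disjoint claws (which are linked by a path).
   Context: A claw is a subgraph isomorphic to $K_{1,3}$. Let $T_1$ be the countably infinite tree defined as follows: its root $r$ has countably infinitely many children, each child of $r$ has exactly two children, and every node not in $N[r]$ has exactly one parent and exactly one child. $\mathcal T_1$ is the set of finite connected induced subgraphs of $T_1$ (up to isomorphism). -}

module Defs where

open import Data.Nat using (ℕ; zero; suc; _≥_)
open import Data.Bool using (Bool; true; false)
open import Data.Fin using (Fin; zero; suc; inject₁; fromℕ)
open import Data.Product using (Σ; ∃; _×_; _,_)
open import Data.Sum using (_⊎_)
open import Relation.Nullary using (¬_)
open import Relation.Binary.PropositionalEquality using (_≡_; _≢_)
open import Function.Definitions using (Injective)

record Graph : Set where
  field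
    n     : ℕ
    adj   : Fin n → Fin n → Bool
    sym   : ∀ u v → adj u v ≡ adj v u
    irrefl : ∀ u → adj u u ≡ false

module _ (G : Graph) where
  open Graph G

  Adj : Fin n → Fin n → Set
  Adj u v = adj u v ≡ true

  data Walk : Fin n → Fin n → Set where
    here : ∀ {u} → Walk u u
    step : ∀ {u w v} → Adj u w → Walk w v → Walk u v

  Connected : Set
  Connected = ∀ u v → Walk u v

  record Cycle : Set where
    field
      k    : ℕ
      c    : Fin (suc (suc (suc k))) → Fin n
      inj  : Injective _≡_ _≡_ c
      cons : ∀ (i : Fin (suc (suc k))) → Adj (c (inject₁ i)) (c (suc i))
      close : Adj (c (fromℕ (suc (suc k)))) (c zero)

  Acyclic : Set
  Acyclic = ¬ Cycle

  IsTree : Set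
  IsTree = (n ≥ 1) × Connected × Acyclic

  record Claw : Set where
    field
      centre l₁ l₂ l₃ : Fin n
      a₁ : Adj centre l₁
      a₂ : Adj centre l₂
      a₃ : Adj centre l₃
      d₀₁ : centre ≢ l₁
      d₀₂ : centre ≢ l₂
      d₀₃ : centre ≢ l₃
      d₁₂ : l₁ ≢ l₂
      d₁₃ : l₁ ≢ l₃
      d₂₃ : l₂ ≢ l₃

  clawV : Claw → Fin n → Set
  clawV C x = (x ≡ Claw.centre C) ⊎ (x ≡ Claw.l₁ C) ⊎ (x ≡ Claw.l₂ C) ⊎ (x ≡ Claw.l₃ C)

  VertexDisjoint : Claw → Claw → Set
  VertexDisjoint C D = ∀ x → clawV C x → ¬ clawV D x

-- The infinite tree T₁
-- root; mid i = the i-th child of the root; leg i b j = the vertex at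
-- depth j (j = 0 is the child of mid i) on the branch b below mid i.

data T1V : Set where
  root : T1V
  mid  : ℕ → T1V
  leg  : ℕ → Bool → ℕ → T1V

data T1Edge : T1V → T1V → Set where
  r-m : ∀ i → T1Edge root (mid i)
  m-l : ∀ i b → T1Edge (mid i) (leg i b zero)
  l-l : ∀ i b j → T1Edge (leg i b j) (leg i b (suc j))

T1Adj : T1V → T1V → Set
T1Adj x y = T1Edge x y ⊎ T1Edge y x

-- G ∈ 𝒯₁ : G is connected and isomorphic to an induced subgraph of T₁,
-- i.e. there is an injective map V(G) → V(T₁) that preserves and
-- reflects adjacency (its image is then a finite connected induced subgraph).
InT1 : Graph → Set
InT1 G = Connected G × Σ (Fin (Graph.n G) → T1V) λ f →
  Injective _≡_ _≡_ f ×
  (∀ u v → (Adj G u v → T1Adj (f u) (f v)) × (T1Adj (f u) (f v) → Adj G u v))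

module Submission where

-- Root the tree at a vertex c; acyclicity makes every edge join a vertex to its breadth-first
-- parent. If no child of c has three children and no deeper vertex has two, the tree embeds in T₁:
-- c goes to the root, each child v of c to a middle vertex, and the descendants of v to the two
-- legs below it. So in a tree outside 𝒯₁ every root is obstructed: a neighbour has degree ≥ 4, or
-- a vertex at distance ≥ 2 has degree ≥ 3. If some vertex has degree ≥ 4, root the tree there and
-- separate the claws at the root and at its obstruction by depth. Otherwise root it at a vertex u
-- of degree 3, whose obstruction v has degree 3. At distance ≥ 3 the closed neighbourhoods of u and
-- v are disjoint; at distance 2 the obstruction of the middle vertex is a third vertex of degree 3,
-- either far from u or in a different subtree of u than v.

open import Defs
open import Data.Bool using (Bool; true)
open import Data.Bool.Properties using () renaming (_≟_ to _≟ᵇ_)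
open import Data.Empty using (⊥-elim)
open import Data.Fin using (Fin; zero; suc; toℕ; inject₁; fromℕ; fromℕ<; _≟_)
open import Data.Fin.Properties using (any?; all?; toℕ-injective; ¬∀⟶∃¬)
open import Data.List using (List; []; _∷_; _++_; [_]; length; lookup)
open import Data.List.Properties using (length-++-≤ˡ; length-++-≤ʳ)
open import Data.List.Membership.Propositional.Properties using (∈-lookup)
open import Data.List.Relation.Unary.All as All using (All; []; _∷_)
import Data.List.Relation.Unary.All.Properties as All
open import Data.List.Relation.Unary.AllPairs using ([]; _∷_)
import Data.List.Relation.Unary.AllPairs.Properties as AllPairs
open import Data.List.Relation.Unary.Unique.Propositional using (Unique)
open import Data.Nat using (ℕ; zero; suc; pred; _≤_; _<_; _∸_; z≤n; s≤s; ≢-nonZero)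
  renaming (_≟_ to _≟ⁿ_)
open import Data.Nat.GeneralisedArithmetic using (iterate; iterate-is-fold)
open import Data.Nat.Properties hiding (_≟_)
open import Data.Product using (Σ; Σ-syntax; ∃; _×_; _,_; proj₁; proj₂)
open import Data.Sum using (_⊎_; inj₁; inj₂)
open import Data.Unit using (⊤; tt)
open import Function using (_∘_)
open import Relation.Nullary using (¬_; Dec; yes; no; does)
open import Relation.Nullary.Decidable using (_×-dec_; _⊎-dec_; ¬?; decidable-stable)
open import Relation.Unary using (Decidable)
open import Relation.Binary.Definitions using (tri<; tri≈; tri>)
open import Relation.Binary.PropositionalEquality hiding ([_])

leastWitness : {P : ℕ → Set} → Decidable P → ∀ m → P m →
               Σ[ k ∈ ℕ ] P k × (∀ {j} → P j → k ≤ j)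
leastWitness P? m pm with P? zero
... | yes p₀ = zero , p₀ , λ _ → z≤n
leastWitness P? zero pm | no ¬p₀ = ⊥-elim (¬p₀ pm)
leastWitness P? (suc m) pm | no ¬p₀ with leastWitness (P? ∘ suc) m pm
... | k , pk , minimal = suc k , pk , λ { {zero} p → ⊥-elim (¬p₀ p) ; {suc j} p → s≤s (minimal p) }

module _ {A : Set} {P : A → Set} where

  witnessOr : A → Dec (∃ P) → A
  witnessOr _ (yes (w , _)) = w
  witnessOr d (no _)        = d

  witnessOr-satisfies : ∀ d (p? : Dec (∃ P)) → ∃ P → P (witnessOr d p?)
  witnessOr-satisfies _ (yes (_ , p)) _ = p
  witnessOr-satisfies _ (no ¬p)       e = ⊥-elim (¬p e)

  witnessOr-default : ∀ d (p? : Dec (∃ P)) → ¬ ∃ P → witnessOr d p? ≡ d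
  witnessOr-default _ (yes e) ¬e = ⊥-elim (¬e e)
  witnessOr-default _ (no _)  _  = refl

iterate-suc : ∀ {A : Set} (f : A → A) x m → iterate f x (suc m) ≡ f (iterate f x m)
iterate-suc f x m = trans (sym (iterate-is-fold x f (suc m))) (cong f (iterate-is-fold x f m))

m≡2+n⇒2≤m : ∀ {m n} → m ≡ suc (suc n) → 2 ≤ m
m≡2+n⇒2≤m refl = s≤s (s≤s z≤n)

m≡3+n⇒3≤m : ∀ {m n} → m ≡ suc (suc (suc n)) → 3 ≤ m
m≡3+n⇒3≤m refl = s≤s (s≤s (s≤s z≤n))

level : T1V → ℕ
level root        = 0
level (mid _)     = 1
level (leg _ _ k) = suc (suc k)

T1Edge-level : ∀ {x y} → T1Edge x y → level y ≡ suc (level x)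
T1Edge-level (r-m _)     = refl
T1Edge-level (m-l _ _)   = refl
T1Edge-level (l-l _ _ _) = refl

T1Edge-parent-unique : ∀ {x x′ y} → T1Edge x y → T1Edge x′ y → x ≡ x′
T1Edge-parent-unique (r-m _)     (r-m _)     = refl
T1Edge-parent-unique (m-l _ _)   (m-l _ _)   = refl
T1Edge-parent-unique (l-l _ _ _) (l-l _ _ _) = refl

mid-injective : ∀ {i j} → mid i ≡ mid j → i ≡ j
mid-injective refl = refl

leg-injective : ∀ {i j b b′ k k′} → leg i b k ≡ leg j b′ k′ → i ≡ j × b ≡ b′
leg-injective refl = refl , refl

TwoDisjointClaws : Graph → Set
TwoDisjointClaws G = Σ[ C ∈ Claw G ] Σ[ D ∈ Claw G ] VertexDisjoint G C D

module Tree (G : Graph) (connected : Connected G) (acyclic : Acyclic G) where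
  open Graph G renaming (sym to adj-sym)

  infix 4 _~_ _~?_

  _~_ : Fin n → Fin n → Set
  _~_ = Adj G

  _~?_ : ∀ u v → Dec (u ~ v)
  u ~? v = adj u v ≟ᵇ true

  ~-sym : ∀ {u v} → u ~ v → v ~ u
  ~-sym {u} {v} a = trans (adj-sym v u) a

  ~-irrefl : ∀ {u} → ¬ u ~ u
  ~-irrefl {u} a with () ← trans (sym a) (irrefl u)

  ~⇒≢ : ∀ {u v} → u ~ v → u ≢ v
  ~⇒≢ a refl = ~-irrefl a

  ClawAt : Fin n → (Fin n → Set) → Set
  ClawAt v R = Σ[ x ∈ Fin n ] Σ[ y ∈ Fin n ] Σ[ z ∈ Fin n ]
    v ~ x × v ~ y × v ~ z × x ≢ y × x ≢ z × y ≢ z × R x × R y × R z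

  clawAt? : ∀ v {R} → Decidable R → Dec (ClawAt v R)
  clawAt? v R? = any? λ x → any? λ y → any? λ z →
    v ~? x ×-dec v ~? y ×-dec v ~? z ×-dec ¬? (x ≟ y) ×-dec ¬? (x ≟ z) ×-dec ¬? (y ≟ z) ×-dec
    R? x ×-dec R? y ×-dec R? z

  Deg≥3 : Fin n → Set
  Deg≥3 v = ClawAt v (λ _ → ⊤)

  deg≥3? : Decidable Deg≥3
  deg≥3? v = clawAt? v (λ _ → yes tt)

  Deg≥4 : Fin n → Set
  Deg≥4 v = Σ[ w ∈ Fin n ] v ~ w × ClawAt v (_≢ w)

  deg≥4? : Decidable Deg≥4
  deg≥4? v = any? λ w → v ~? w ×-dec clawAt? v (λ x → ¬? (x ≟ w))

  deg≥4-avoiding : ∀ {v} → Deg≥4 v → ∀ a → ClawAt v (_≢ a)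
  deg≥4-avoiding (w , vw , x , y , z , vx , vy , vz , x≢y , x≢z , y≢z , x≢w , y≢w , z≢w) a
    with x ≟ a | y ≟ a | z ≟ a
  ... | yes refl | _        | _        =
    w , y , z , vw , vy , vz , ≢-sym y≢w , ≢-sym z≢w , y≢z , ≢-sym x≢w , ≢-sym x≢y , ≢-sym x≢z
  ... | no x≢a   | yes refl | _        =
    x , w , z , vx , vw , vz , x≢w , x≢z , ≢-sym z≢w , x≢a , ≢-sym y≢w , ≢-sym y≢z
  ... | no x≢a   | no y≢a   | yes refl =
    x , y , w , vx , vy , vw , x≢y , x≢w , y≢w , x≢a , y≢a , ≢-sym z≢w
  ... | no x≢a   | no y≢a   | no z≢a   =
    x , y , z , vx , vy , vz , x≢y , x≢z , y≢z , x≢a , y≢a , z≢a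

  clawAt-map : ∀ {v R S} → (∀ {x} → v ~ x → R x → S x) → ClawAt v R → ClawAt v S
  clawAt-map f (x , y , z , vx , vy , vz , x≢y , x≢z , y≢z , rx , ry , rz) =
    x , y , z , vx , vy , vz , x≢y , x≢z , y≢z , f vx rx , f vy ry , f vz rz

  toClaw : ∀ {v R} → ClawAt v R → Claw G
  toClaw {v} (x , y , z , vx , vy , vz , x≢y , x≢z , y≢z , _) = record
    { centre = v ; l₁ = x ; l₂ = y ; l₃ = z ; a₁ = vx ; a₂ = vy ; a₃ = vz
    ; d₀₁ = ~⇒≢ vx ; d₀₂ = ~⇒≢ vy ; d₀₃ = ~⇒≢ vz
    ; d₁₂ = x≢y ; d₁₃ = x≢z ; d₂₃ = y≢z
    }

  toClaw-vertices : ∀ {v R} (h : ClawAt v R) {Q : Fin n → Set} → Q v → (∀ {x} → v ~ x → R x → Q x) →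
                    ∀ w → clawV G (toClaw h) w → Q w
  toClaw-vertices _ qv _ _ (inj₁ refl) = qv
  toClaw-vertices (_ , _ , _ , vx , _ , _ , _ , _ , _ , rx , _) _ q _ (inj₂ (inj₁ refl)) = q vx rx
  toClaw-vertices (_ , _ , _ , _ , vy , _ , _ , _ , _ , _ , ry , _) _ q _ (inj₂ (inj₂ (inj₁ refl))) = q vy ry
  toClaw-vertices (_ , _ , _ , _ , _ , vz , _ , _ , _ , _ , _ , rz) _ q _ (inj₂ (inj₂ (inj₂ refl))) = q vz rz

  twoClaws-separatedBy : ∀ {u v R S} (Q : Fin n → Set) → ClawAt u R → ClawAt v S →
                   Q u → (∀ {x} → u ~ x → R x → Q x) → ¬ Q v → (∀ {x} → v ~ x → S x → ¬ Q x) →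
                   TwoDisjointClaws G
  twoClaws-separatedBy Q hu hv qu qx ¬qv ¬qx =
    toClaw hu , toClaw hv , λ w inC inD →
      toClaw-vertices hv ¬qv ¬qx w inD (toClaw-vertices hu qu qx w inC)

  -- The vertices that prevent c from being the root of an embedding into T₁: a child of c with
  -- three children, or a deeper vertex with two children.
  Obstruction : Fin n → Set
  Obstruction c = ∃ λ v → (c ~ v × Deg≥4 v) ⊎ (v ≢ c × ¬ c ~ v × Deg≥3 v)

  obstruction? : Decidable Obstruction
  obstruction? c = any? λ v →
    (c ~? v ×-dec deg≥4? v) ⊎-dec (¬? (v ≟ c) ×-dec ¬? (c ~? v) ×-dec deg≥3? v)

  infixr 5 _∷ₚ_
  data Path : Fin n → Fin n → List (Fin n) → Set where
    end  : ∀ {x} → Path x x [ x ]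
    _∷ₚ_ : ∀ {x y z xs} → x ~ y → Path y z xs → Path x z (x ∷ xs)

  _∷ʳₚ_ : ∀ {x y z xs} → Path x y xs → y ~ z → Path x z (xs ++ [ z ])
  end      ∷ʳₚ a = a ∷ₚ end
  (b ∷ₚ p) ∷ʳₚ a = b ∷ₚ (p ∷ʳₚ a)

  path-~ : ∀ {x y w ws} → Path x y (w ∷ ws) →
           ∀ i → lookup (w ∷ ws) (inject₁ i) ~ lookup (w ∷ ws) (suc i)
  path-~ (a ∷ₚ end)             zero    = a
  path-~ (a ∷ₚ _ ∷ₚ _)          zero    = a
  path-~ (_ ∷ₚ p@(_ ∷ₚ _))      (suc i) = path-~ p i

  path-last : ∀ {x y w ws} → Path x y (w ∷ ws) → lookup (w ∷ ws) (fromℕ (length ws)) ≡ y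
  path-last end                = refl
  path-last (_ ∷ₚ end)         = refl
  path-last (_ ∷ₚ p@(_ ∷ₚ _))  = path-last p

  lookup-injective : ∀ {xs : List (Fin n)} → Unique xs → ∀ i j → lookup xs i ≡ lookup xs j → i ≡ j
  lookup-injective (_   ∷ _) zero    zero    _ = refl
  lookup-injective (x∉ ∷ _) zero    (suc j) e = ⊥-elim (All.lookup x∉ (∈-lookup j) e)
  lookup-injective (x∉ ∷ _) (suc i) zero    e = ⊥-elim (All.lookup x∉ (∈-lookup i) (sym e))
  lookup-injective (_   ∷ u) (suc i) (suc j) e = cong suc (lookup-injective u i j e)

  unique-∷ʳ : ∀ {xs : List (Fin n)} {y} → Unique xs → All (_≢ y) xs → Unique (xs ++ [ y ])
  unique-∷ʳ u ne = AllPairs.++⁺ u ([] ∷ []) (All.map (_∷ []) ne)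

  closedPath-impossible : ∀ {x y xs} → Path x y xs → Unique xs → 3 ≤ length xs → ¬ y ~ x
  closedPath-impossible {xs = a ∷ b ∷ d ∷ rest} p@(_ ∷ₚ _) u _ y~x = acyclic record
    { k     = length rest
    ; c     = lookup (a ∷ b ∷ d ∷ rest)
    ; inj   = λ {i} {j} → lookup-injective u i j
    ; cons  = path-~ p
    ; close = subst (_~ a) (sym (path-last p)) y~x
    }
  closedPath-impossible {xs = _ ∷ _ ∷ []} _ _ (s≤s (s≤s ()))
  closedPath-impossible {xs = _ ∷ []}     _ _ (s≤s ())

  module Rooted (c : Fin n) where

    Reach : ℕ → Fin n → Set
    Reach zero    v = v ≡ c
    Reach (suc k) v = Reach k v ⊎ ∃ λ w → Reach k w × w ~ v

    reach? : ∀ k → Decidable (Reach k)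
    reach? zero    v = v ≟ c
    reach? (suc k) v = reach? k v ⊎-dec any? λ w → reach? k w ×-dec w ~? v

    walk⇒reach : ∀ {k x v} → Reach k x → Walk G x v → ∃ λ m → Reach m v
    walk⇒reach r here       = _ , r
    walk⇒reach r (step a w) = walk⇒reach (inj₂ (_ , r , a)) w

    leastReach : ∀ v → Σ[ k ∈ ℕ ] Reach k v × (∀ {j} → Reach j v → k ≤ j)
    leastReach v with walk⇒reach refl (connected c v)
    ... | m , r = leastWitness (λ k → reach? k v) m r

    depth : Fin n → ℕ
    depth v = proj₁ (leastReach v)

    reach-depth : ∀ v → Reach (depth v) v
    reach-depth v = proj₁ (proj₂ (leastReach v))

    depth-minimal : ∀ {k v} → Reach k v → depth v ≤ k
    depth-minimal {v = v} = proj₂ (proj₂ (leastReach v))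

    depth-root : depth c ≡ 0
    depth-root = n≤0⇒n≡0 (depth-minimal refl)

    depth≡0⇒root : ∀ {v} → depth v ≡ 0 → v ≡ c
    depth≡0⇒root {v} d≡0 = subst (λ k → Reach k v) d≡0 (reach-depth v)

    depth≡suc⇒≢root : ∀ {v k} → depth v ≡ suc k → v ≢ c
    depth≡suc⇒≢root d≡ refl = 0≢1+n (trans (sym depth-root) d≡)

    <depth⇒≢root : ∀ {k v} → k < depth v → v ≢ c
    <depth⇒≢root k<d refl = n≮0 (subst (_ <_) depth-root k<d)

    depth-~ : ∀ {u v} → u ~ v → depth v ≤ suc (depth u)
    depth-~ {u} a = depth-minimal (inj₂ (u , reach-depth u , a))

    ParentOf : Fin n → Fin n → Set
    ParentOf w v = Reach (pred (depth v)) w × w ~ v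

    -- c is its own parent: the default of the search.
    parent : Fin n → Fin n
    parent v = witnessOr c (any? λ w → reach? (pred (depth v)) w ×-dec w ~? v)

    parentOf-exists : ∀ {v} → v ≢ c → ∃ λ w → ParentOf w v
    parentOf-exists {v} v≢c with depth v in d≡ | reach-depth v
    ... | zero  | r        = ⊥-elim (v≢c r)
    ... | suc k | inj₁ r   = ⊥-elim (1+n≰n (subst (_≤ k) d≡ (depth-minimal r)))
    ... | suc k | inj₂ wit = wit

    parent-parentOf : ∀ {v} → v ≢ c → ParentOf (parent v) v
    parent-parentOf {v} v≢c = witnessOr-satisfies c (any? λ w → reach? (pred (depth v)) w ×-dec w ~? v)
                                                  (parentOf-exists v≢c)

    parent-~ : ∀ {v} → v ≢ c → parent v ~ v
    parent-~ = proj₂ ∘ parent-parentOf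

    parent-root : parent c ≡ c
    parent-root = witnessOr-default c (any? λ w → reach? (pred (depth c)) w ×-dec w ~? c) no-parent
      where
        no-parent : ¬ ∃ λ w → ParentOf w c
        no-parent (w , r , a) = ~-irrefl (subst (_~ c) (depth≡0⇒root depth-w≡0) a)
          where depth-w≡0 = n≤0⇒n≡0 (subst (λ k → depth w ≤ pred k) depth-root (depth-minimal r))

    depth-parent : ∀ {v} → v ≢ c → depth v ≡ suc (depth (parent v))
    depth-parent {v} v≢c =
      ≤-antisym (depth-~ a) (m≤pred[n]⇒suc[m]≤n {{≢-nonZero depth≢0}} (depth-minimal r))
      where
        r = proj₁ (parent-parentOf v≢c)
        a = proj₂ (parent-parentOf v≢c)
        depth≢0 : depth v ≢ 0
        depth≢0 = v≢c ∘ depth≡0⇒root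

    depth-parent-pred : ∀ {v d} → depth v ≡ suc d → depth (parent v) ≡ d
    depth-parent-pred dv = suc-injective (trans (sym (depth-parent (depth≡suc⇒≢root dv))) dv)

    deeper-∉ : ∀ {d x ws} → depth x ≡ suc d → All (λ w → depth w ≤ d) ws → All (x ≢_) ws
    deeper-∉ {d} dx = All.map λ w≤d x≡w →
      1+n≰n (subst (_≤ d) dx (subst (λ u → depth u ≤ d) (sym x≡w) w≤d))

    record Bridge (d : ℕ) (x y : Fin n) : Set where
      field
        vertices : List (Fin n)
        path     : Path x y vertices
        unique   : Unique vertices
        shallow  : All (λ w → depth w ≤ d) vertices
        long     : 3 ≤ length vertices

    widen : ∀ {d x y p q vs} → depth x ≡ suc d → depth y ≡ suc d → x ≢ y → x ~ p → q ~ y →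
            Path p q vs → Unique vs → All (λ w → depth w ≤ d) vs → Bridge (suc d) x y
    widen {vs = []} _ _ _ _ _ () _ _
    widen {d} {x} {y} {vs = v ∷ rest} dx dy x≢y xp qy pq u sh = record
      { vertices = x ∷ v ∷ rest ++ [ y ]
      ; path     = xp ∷ₚ (pq ∷ʳₚ qy)
      ; unique   = All.++⁺ (deeper-∉ dx sh) (x≢y ∷ []) ∷ unique-∷ʳ u (All.map ≢-sym (deeper-∉ dy sh))
      ; shallow  = ≤-reflexive dx ∷ All.++⁺ (All.map m≤n⇒m≤1+n sh) (≤-reflexive dy ∷ [])
      ; long     = s≤s (s≤s (length-++-≤ʳ [ y ] {rest}))
      }

    bridge : ∀ d {x y} → depth x ≡ d → depth y ≡ d → x ≢ y → Bridge d x y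
    bridge zero    dx dy x≢y = ⊥-elim (x≢y (trans (depth≡0⇒root dx) (sym (depth≡0⇒root dy))))
    bridge (suc d) {x} {y} dx dy x≢y = viaParents (parent x ≟ parent y)
      where
        x≢c = depth≡suc⇒≢root dx
        y≢c = depth≡suc⇒≢root dy
        viaParents : Dec (parent x ≡ parent y) → Bridge (suc d) x y
        viaParents (yes px≡py) =
          widen dx dy x≢y (~-sym (parent-~ x≢c)) (subst (_~ y) (sym px≡py) (parent-~ y≢c))
                end ([] ∷ []) (≤-reflexive (depth-parent-pred dx) ∷ [])
        viaParents (no px≢py)  = widen dx dy x≢y (~-sym (parent-~ x≢c)) (parent-~ y≢c) path unique shallow
          where open Bridge (bridge d (depth-parent-pred dx) (depth-parent-pred dy) px≢py)

    -- A bridge closed by an edge is a cycle; this rules out edges inside a level and a second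
    -- neighbour one level up.
    parent-unique : ∀ {u v} → u ~ v → depth v ≡ suc (depth u) → parent v ≡ u
    parent-unique {u} {v} a dv with parent v ≟ u
    ... | yes pv≡u = pv≡u
    ... | no pv≢u = ⊥-elim (closedPath-impossible (path ∷ʳₚ parent-~ (depth≡suc⇒≢root dv))
                              (unique-∷ʳ unique (All.map ≢-sym (deeper-∉ dv shallow)))
                              (≤-trans long (length-++-≤ˡ vertices)) (~-sym a))
      where open Bridge (bridge (depth u) refl (depth-parent-pred dv) (≢-sym pv≢u))

    adjacent-parent : ∀ {u v} → u ~ v → (parent v ≡ u × depth v ≡ suc (depth u)) ⊎
                                         (parent u ≡ v × depth u ≡ suc (depth v))
    adjacent-parent {u} {v} a with <-cmp (depth u) (depth v)
    ... | tri< du<dv _ _ = let dv≡ = ≤-antisym (depth-~ a) du<dv in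
                           inj₁ (parent-unique a dv≡ , dv≡)
    ... | tri> _ _ dv<du = let du≡ = ≤-antisym (depth-~ (~-sym a)) dv<du in
                           inj₂ (parent-unique (~-sym a) du≡ , du≡)
    ... | tri≈ _ du≡dv _ = ⊥-elim (closedPath-impossible path unique long (~-sym a))
      where open Bridge (bridge (depth u) refl (sym du≡dv) (~⇒≢ a))

    depth-parent≡pred : ∀ v → depth (parent v) ≡ pred (depth v)
    depth-parent≡pred v = byCases (v ≟ c)
      where
        byCases : Dec (v ≡ c) → depth (parent v) ≡ pred (depth v)
        byCases (yes v≡c) = subst (λ w → depth (parent w) ≡ pred (depth w)) (sym v≡c)
                              (trans (cong depth parent-root) (trans depth-root (cong pred (sym depth-root))))
        byCases (no v≢c)  = cong pred (sym (depth-parent v≢c))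

    ancestor : ℕ → Fin n → Fin n
    ancestor k v = iterate parent v (depth v ∸ k)

    depth-iterate : ∀ m v → depth (iterate parent v m) ≡ depth v ∸ m
    depth-iterate zero    v = refl
    depth-iterate (suc m) v = begin
      depth (iterate parent v (suc m))   ≡⟨ cong depth (iterate-suc parent v m) ⟩
      depth (parent (iterate parent v m)) ≡⟨ depth-parent≡pred _ ⟩
      pred (depth (iterate parent v m))  ≡⟨ cong pred (depth-iterate m v) ⟩
      pred (depth v ∸ m)                 ≡⟨ pred[m∸n]≡m∸[1+n] (depth v) m ⟩
      depth v ∸ suc m                    ∎
      where open ≡-Reasoning

    depth-ancestor : ∀ {k} v → k ≤ depth v → depth (ancestor k v) ≡ k
    depth-ancestor {k} v k≤d = trans (depth-iterate (depth v ∸ k) v) (m∸[m∸n]≡n k≤d)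

    ancestor-self : ∀ {k} v → depth v ≡ k → ancestor k v ≡ v
    ancestor-self {k} v d≡k = cong (iterate parent v) (trans (cong (_∸ k) d≡k) (n∸n≡0 k))

    ancestor-root : ∀ k → ancestor k c ≡ c
    ancestor-root k = iterate-root (depth c ∸ k)
      where
        iterate-root : ∀ m → iterate parent c m ≡ c
        iterate-root zero    = refl
        iterate-root (suc m) = trans (cong (λ x → iterate parent x m) parent-root) (iterate-root m)

    ancestor-parent : ∀ {k} v → k < depth v → ancestor k (parent v) ≡ ancestor k v
    ancestor-parent {k} v k<d = sym (cong (iterate parent v) steps)
      where
        d≡ : depth v ≡ suc (depth (parent v))
        d≡ = depth-parent (<depth⇒≢root k<d)
        steps : depth v ∸ k ≡ suc (depth (parent v) ∸ k)
        steps = trans (cong (_∸ k) d≡) (+-∸-assoc 1 (≤-pred (subst (suc k ≤_) d≡ k<d)))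

    ancestor-step : ∀ {k} v → suc k ≤ depth v → ancestor k v ≡ parent (ancestor (suc k) v)
    ancestor-step {k} v k<d =
      trans (cong (iterate parent v) (+-∸-assoc 1 k<d)) (iterate-suc parent v (depth v ∸ suc k))

    ~-child : ∀ {u v} → u ~ v → v ≢ parent u → depth v ≡ suc (depth u)
    ~-child a v≢pu with adjacent-parent a
    ... | inj₁ (_ , dv)   = dv
    ... | inj₂ (pu≡v , _) = ⊥-elim (v≢pu (sym pu≡v))

    root-~ : ∀ {v} → c ~ v → depth v ≡ 1
    root-~ a = trans (~-child a λ v≡pc → ~⇒≢ a (sym (trans v≡pc parent-root))) (cong suc depth-root)

    parent-depth₁ : ∀ {v} → depth v ≡ 1 → parent v ≡ c
    parent-depth₁ dv = depth≡0⇒root (depth-parent-pred dv)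

    depth₁⇒root-~ : ∀ {v} → depth v ≡ 1 → c ~ v
    depth₁⇒root-~ {v} dv = subst (_~ v) (parent-depth₁ dv) (parent-~ (depth≡suc⇒≢root dv))

    nonNeighbour-depth : ∀ {v} → v ≢ c → ¬ c ~ v → 2 ≤ depth v
    nonNeighbour-depth {v} v≢c c≁v = byDepth (depth v) refl
      where
        byDepth : ∀ d → depth v ≡ d → 2 ≤ d
        byDepth zero          dv = ⊥-elim (v≢c (depth≡0⇒root dv))
        byDepth (suc zero)    dv = ⊥-elim (c≁v (depth₁⇒root-~ dv))
        byDepth (suc (suc _)) _  = s≤s (s≤s z≤n)

    depth-root≤1 : depth c ≤ 1
    depth-root≤1 = ≤-trans (≤-reflexive depth-root) z≤n

    ancestor₁-~ : ∀ {u v} → u ~ v → 1 ≤ depth u → 1 ≤ depth v → ancestor 1 u ≡ ancestor 1 v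
    ancestor₁-~ a 1≤du 1≤dv with adjacent-parent a
    ... | inj₁ (pv≡u , dv) =
      trans (cong (ancestor 1) (sym pv≡u)) (ancestor-parent _ (subst (1 <_) (sym dv) (s≤s 1≤du)))
    ... | inj₂ (pu≡v , du) =
      sym (trans (cong (ancestor 1) (sym pu≡v)) (ancestor-parent _ (subst (1 <_) (sym du) (s≤s 1≤dv))))

    ancestor₁-depth₂ : ∀ {v} → depth v ≡ 2 → ancestor 1 v ≡ parent v
    ancestor₁-depth₂ {v} dv = trans (ancestor-step v (≤-reflexive (sym dv))) (cong parent (ancestor-self v dv))

    Child : Fin n → Fin n → Set
    Child x v = x ≢ c × parent x ≡ v

    child? : ∀ x v → Dec (Child x v)
    child? x v = ¬? (x ≟ c) ×-dec parent x ≟ v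

    child-depth : ∀ {x v} → Child x v → depth x ≡ suc (depth v)
    child-depth {x} (x≢c , px≡v) = subst (λ p → depth x ≡ suc (depth p)) px≡v (depth-parent x≢c)

    child-~ : ∀ {x v} → Child x v → v ~ x
    child-~ {x} (x≢c , px≡v) = subst (_~ x) px≡v (parent-~ x≢c)

    child≢parent : ∀ {x v} → Child x v → x ≢ parent v
    child≢parent {x} {v} cx x≡pv = 1+n≰n (subst (_≤ depth v) pred≡suc pred[n]≤n)
      where pred≡suc = trans (sym (trans (cong depth x≡pv) (depth-parent≡pred v))) (child-depth cx)

    AtMostTwoChildren : Fin n → Set
    AtMostTwoChildren v = ∀ {x y z} → Child x v → Child y v → Child z v → x ≡ y ⊎ x ≡ z ⊎ y ≡ z

    AtMostOneChild : Fin n → Set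
    AtMostOneChild v = ∀ {x y} → Child x v → Child y v → x ≡ y

    module Embedding (twoChildren : ∀ {v} → depth v ≡ 1 → AtMostTwoChildren v)
                     (oneChild : ∀ {v} → 2 ≤ depth v → AtMostOneChild v) where

      SmallerSibling : Fin n → Fin n → Set
      SmallerSibling w s = Child w (parent s) × toℕ w < toℕ s

      smallerSibling? : ∀ w s → Dec (SmallerSibling w s)
      smallerSibling? w s = child? w (parent s) ×-dec toℕ w <? toℕ s

      IsFirstChild : Fin n → Set
      IsFirstChild s = ∀ w → ¬ SmallerSibling w s

      isFirstChild? : Decidable IsFirstChild
      isFirstChild? s = all? λ w → ¬? (smallerSibling? w s)

      smallerSibling : ∀ {s} → ¬ IsFirstChild s → ∃ λ w → SmallerSibling w s
      smallerSibling {s} ¬first with ¬∀⟶∃¬ n _ (λ w → ¬? (smallerSibling? w s)) ¬first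
      ... | w , ¬¬smaller = w , decidable-stable (smallerSibling? w s) ¬¬smaller

      otherSibling-smaller : ∀ {v s s′} → depth v ≡ 1 → Child s v → Child s′ v → s ≢ s′ →
                             ¬ IsFirstChild s → toℕ s′ < toℕ s
      otherSibling-smaller {v} {s} dv cs cs′ s≢s′ ¬first with smallerSibling ¬first
      ... | w , cw , w<s with twoChildren dv cs cs′ (subst (Child w) (proj₂ cs) cw)
      ...   | inj₁ s≡s′        = ⊥-elim (s≢s′ s≡s′)
      ...   | inj₂ (inj₁ s≡w)  = ⊥-elim (<-irrefl (cong toℕ (sym s≡w)) w<s)
      ...   | inj₂ (inj₂ s′≡w) = subst (λ t → toℕ t < toℕ s) (sym s′≡w) w<s

      firstness-injective : ∀ {v s s′} → depth v ≡ 1 → Child s v → Child s′ v →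
                            (d : Dec (IsFirstChild s)) (d′ : Dec (IsFirstChild s′)) →
                            does d ≡ does d′ → s ≡ s′
      firstness-injective {s = s} {s′} _ cs cs′ (yes first) (yes first′) _ = toℕ-injective (≤-antisym
        (≮⇒≥ λ s′<s → first  _ (subst (Child s′) (sym (proj₂ cs)) cs′ , s′<s))
        (≮⇒≥ λ s<s′ → first′ _ (subst (Child s) (sym (proj₂ cs′)) cs , s<s′)))
      firstness-injective _ _ _ (yes _) (no _) ()
      firstness-injective _ _ _ (no _) (yes _) ()
      firstness-injective {s = s} {s′} dv cs cs′ (no ¬first) (no ¬first′) _ with s ≟ s′
      ... | yes s≡s′ = s≡s′
      ... | no s≢s′  = ⊥-elim (<-asym (otherSibling-smaller dv cs cs′ s≢s′ ¬first)
                                      (otherSibling-smaller dv cs′ cs (≢-sym s≢s′) ¬first′))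

      isFirstChild : Fin n → Bool
      isFirstChild s = does (isFirstChild? s)

      ancestor₂-injective : ∀ d {u v} → depth u ≡ suc (suc d) → depth v ≡ suc (suc d) →
                            ancestor 2 u ≡ ancestor 2 v → u ≡ v
      ancestor₂-injective zero {u} {v} du dv a₂ = trans (sym (ancestor-self u du)) (trans a₂ (ancestor-self v dv))
      ancestor₂-injective (suc d) {u} {v} du dv a₂ =
        oneChild (m≡2+n⇒2≤m dpu) (depth≡suc⇒≢root du , refl) (depth≡suc⇒≢root dv , sym parents)
        where
          dpu = depth-parent-pred du
          parents : parent u ≡ parent v
          parents = ancestor₂-injective d dpu (depth-parent-pred dv)
            (trans (ancestor-parent u (m≡3+n⇒3≤m du)) (trans a₂ (sym (ancestor-parent v (m≡3+n⇒3≤m dv)))))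

      -- A vertex at depth k + 2 lies on leg k below its depth-1 ancestor, on the side given by
      -- whether its depth-2 ancestor is the first of the (at most two) children.
      label : ℕ → Fin n → T1V
      label zero          v = root
      label (suc zero)    v = mid (toℕ v)
      label (suc (suc k)) v = leg (toℕ (ancestor 1 v)) (isFirstChild (ancestor 2 v)) k

      embed : Fin n → T1V
      embed v = label (depth v) v

      level-embed : ∀ v → level (embed v) ≡ depth v
      level-embed v = level-label (depth v)
        where
          level-label : ∀ d → level (label d v) ≡ d
          level-label zero          = refl
          level-label (suc zero)    = refl
          level-label (suc (suc _)) = refl

      label-injective : ∀ d {u v} → depth u ≡ d → depth v ≡ d → label d u ≡ label d v → u ≡ v
      label-injective zero          du dv _ = trans (depth≡0⇒root du) (sym (depth≡0⇒root dv))
      label-injective (suc zero)    _  _  e = toℕ-injective (mid-injective e)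
      label-injective (suc (suc k)) {u} {v} du dv e =
        ancestor₂-injective k du dv
          (firstness-injective (depth-parent-pred (depth-ancestor u 2≤du)) (a₂≢c u 2≤du , refl)
            (a₂≢c v 2≤dv , sym parents) (isFirstChild? _) (isFirstChild? _) (proj₂ (leg-injective e)))
        where
          2≤du = m≡2+n⇒2≤m du ; 2≤dv = m≡2+n⇒2≤m dv
          a₂≢c : ∀ w → 2 ≤ depth w → ancestor 2 w ≢ c
          a₂≢c w 2≤dw = depth≡suc⇒≢root (depth-ancestor w 2≤dw)
          parents : parent (ancestor 2 u) ≡ parent (ancestor 2 v)
          parents = trans (sym (ancestor-step u 2≤du))
                      (trans (toℕ-injective (proj₁ (leg-injective e))) (ancestor-step v 2≤dv))

      embed-injective : ∀ {u v} → embed u ≡ embed v → u ≡ v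
      embed-injective {u} {v} e = label-injective (depth u) refl dv≡du (trans e (cong (λ d → label d v) dv≡du))
        where dv≡du = trans (sym (level-embed v)) (trans (cong level (sym e)) (level-embed u))

      label-edge : ∀ d {u v} → depth u ≡ d → parent v ≡ u → depth v ≡ suc d →
                   T1Edge (label d u) (label (suc d) v)
      label-edge zero          _ _ _ = r-m _
      label-edge (suc zero) {u} {v} _ pv≡u dv =
        subst (λ a → T1Edge (mid (toℕ u)) (leg (toℕ a) (isFirstChild (ancestor 2 v)) 0))
              (sym (trans (ancestor₁-depth₂ dv) pv≡u)) (m-l _ _)
      label-edge (suc (suc k)) {u} {v} _ pv≡u dv =
        subst₂ (λ a₁ a₂ → T1Edge (label (suc (suc k)) u) (leg (toℕ a₁) (isFirstChild a₂) (suc k)))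
          (same-ancestor {1} (≤-trans (s≤s (s≤s z≤n)) 3≤dv)) (same-ancestor {2} 3≤dv) (l-l _ _ k)
        where
          3≤dv = m≡3+n⇒3≤m dv
          same-ancestor : ∀ {j} → j < depth v → ancestor j u ≡ ancestor j v
          same-ancestor {j} j<dv = trans (cong (ancestor j) (sym pv≡u)) (ancestor-parent v j<dv)

      embed-edge : ∀ {u v} → parent v ≡ u → depth v ≡ suc (depth u) → T1Edge (embed u) (embed v)
      embed-edge {u} {v} pv≡u dv =
        subst (λ d → T1Edge (embed u) (label d v)) (sym dv) (label-edge (depth u) refl pv≡u dv)

      embed-reflects : ∀ {u v} → T1Edge (embed u) (embed v) → u ~ v
      embed-reflects {u} {v} t = subst (_~ v) pv≡u (parent-~ v≢c)
        where
          v≢c = depth≡suc⇒≢root (trans (sym (level-embed v)) (trans (T1Edge-level t) (cong suc (level-embed u))))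
          pv≡u = embed-injective (T1Edge-parent-unique (embed-edge refl (depth-parent v≢c)) t)

      embed-adjacency : ∀ u v → (u ~ v → T1Adj (embed u) (embed v)) × (T1Adj (embed u) (embed v) → u ~ v)
      embed-adjacency u v = preserves , reflects
        where
          preserves : u ~ v → T1Adj (embed u) (embed v)
          preserves a with adjacent-parent a
          ... | inj₁ (pv≡u , dv) = inj₁ (embed-edge pv≡u dv)
          ... | inj₂ (pu≡v , du) = inj₂ (embed-edge pu≡v du)
          reflects : T1Adj (embed u) (embed v) → u ~ v
          reflects (inj₁ t) = embed-reflects t
          reflects (inj₂ t) = ~-sym (embed-reflects t)

      inT1 : InT1 G
      inT1 = connected , embed , embed-injective , embed-adjacency

    unobstructed⇒InT1 : ¬ Obstruction c → InT1 G
    unobstructed⇒InT1 ¬ob = Embedding.inT1 atMostTwo atMostOne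
      where
        atMostTwo : ∀ {v} → depth v ≡ 1 → AtMostTwoChildren v
        atMostTwo {v} dv {x} {y} {z} cx cy cz with x ≟ y | x ≟ z | y ≟ z
        ... | yes x≡y | _        | _        = inj₁ x≡y
        ... | no _    | yes x≡z  | _        = inj₂ (inj₁ x≡z)
        ... | no _    | no _     | yes y≡z  = inj₂ (inj₂ y≡z)
        ... | no x≢y  | no x≢z   | no y≢z   = ⊥-elim (¬ob (v , inj₁ (depth₁⇒root-~ dv ,
              parent v , ~-sym (parent-~ (depth≡suc⇒≢root dv)) ,
              x , y , z , child-~ cx , child-~ cy , child-~ cz , x≢y , x≢z , y≢z ,
              child≢parent cx , child≢parent cy , child≢parent cz)))
        atMostOne : ∀ {v} → 2 ≤ depth v → AtMostOneChild v
        atMostOne {v} 2≤dv {x} {y} cx cy with x ≟ y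
        ... | yes x≡y = x≡y
        ... | no x≢y  = ⊥-elim (¬ob (v , inj₂ (v≢c , (λ c~v → <⇒≱ 2≤dv (≤-reflexive (root-~ c~v))) ,
              parent v , x , y , ~-sym (parent-~ v≢c) , child-~ cx , child-~ cy ,
              ≢-sym (child≢parent cx) , ≢-sym (child≢parent cy) , x≢y , tt , tt , tt)))
          where v≢c = <depth⇒≢root 2≤dv

    twoClaws-adjacentDeg≥4 : ∀ {v} → c ~ v → Deg≥4 c → Deg≥4 v → TwoDisjointClaws G
    twoClaws-adjacentDeg≥4 {v} c~v hc hv =
      twoClaws-separatedBy Q (deg≥4-avoiding hc v) (deg≥4-avoiding hv c)
        (depth-root≤1 , ~⇒≢ c~v) (λ a x≢v → ≤-reflexive (root-~ a) , x≢v) (λ q → proj₂ q refl) far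
      where
        Q : Fin n → Set
        Q y = depth y ≤ 1 × y ≢ v
        far : ∀ {y} → v ~ y → y ≢ c → ¬ Q y
        far a y≢c (y≤1 , _) = <⇒≱ (≤-reflexive (sym dy)) y≤1
          where
            dv = root-~ c~v
            dy = trans (~-child a λ y≡pv → y≢c (trans y≡pv (parent-depth₁ dv))) (cong suc dv)

    twoClaws-rootAndDeep : ∀ {v S} → ClawAt c (_≢ parent v) → ClawAt v S → 2 ≤ depth v →
                           TwoDisjointClaws G
    twoClaws-rootAndDeep {v} {S} hc hv 2≤dv =
      twoClaws-separatedBy Q hc hv (depth-root≤1 , c≢pv) (λ a x≢pv → ≤-reflexive (root-~ a) , x≢pv)
        (<⇒≱ 2≤dv ∘ proj₁) far
      where
        Q : Fin n → Set
        Q y = depth y ≤ 1 × y ≢ parent v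
        c≢pv : c ≢ parent v
        c≢pv = ≢-sym (<depth⇒≢root (subst (0 <_) (sym (depth-parent≡pred v)) (<⇒≤pred 2≤dv)))
        far : ∀ {y} → v ~ y → S y → ¬ Q y
        far a _ (y≤1 , y≢pv) =
          <⇒≱ (≤-trans (m≤n⇒m≤1+n 2≤dv) (≤-reflexive (sym (~-child a y≢pv)))) y≤1

    twoClaws-rootAndFar : ∀ {v} → Deg≥3 c → Deg≥3 v → 3 ≤ depth v → TwoDisjointClaws G
    twoClaws-rootAndFar {v} hc hv 3≤dv =
      twoClaws-rootAndDeep (clawAt-map avoid hc) hv (≤-trans (n≤1+n 2) 3≤dv)
      where
        avoid : ∀ {x} → c ~ x → ⊤ → x ≢ parent v
        avoid a _ x≡pv = <⇒≱ (subst (2 ≤_) (sym dx≡) (<⇒≤pred 3≤dv)) (≤-reflexive (root-~ a))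
          where dx≡ = trans (cong depth x≡pv) (depth-parent≡pred v)

    twoClaws-differentSubtrees : ∀ {z v R S} → ClawAt z R → ClawAt v S → 1 ≤ depth z → 2 ≤ depth v →
                                 ancestor 1 z ≢ ancestor 1 v → TwoDisjointClaws G
    twoClaws-differentSubtrees {z} {v} {R} {S} hz hv 1≤dz 2≤dv apart =
      twoClaws-separatedBy (λ y → ancestor 1 y ≢ ancestor 1 v) hz hv apart near-z (λ ne → ne refl) near-v
      where
        1≤dv = ≤-trans (n≤1+n 1) 2≤dv
        root-outside : ancestor 1 c ≢ ancestor 1 v
        root-outside e = depth≡suc⇒≢root (depth-ancestor v 1≤dv) (trans (sym e) (ancestor-root 1))
        near-z : ∀ {y} → z ~ y → R y → ancestor 1 y ≢ ancestor 1 v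
        near-z {y} a _ with depth y ≟ⁿ 0
        ... | yes dy = subst (λ w → ancestor 1 w ≢ ancestor 1 v) (sym (depth≡0⇒root {y} dy)) root-outside
        ... | no  dy = λ e → apart (trans (ancestor₁-~ a 1≤dz (n≢0⇒n>0 dy)) e)
        near-v : ∀ {y} → v ~ y → S y → ¬ ancestor 1 y ≢ ancestor 1 v
        near-v a _ ne = ne (sym (ancestor₁-~ a 1≤dv (≤-pred (≤-trans 2≤dv (depth-~ (~-sym a))))))

    -- z has degree ≥ 3 and is not adjacent to m = parent v: it is either far from c or in a
    -- different subtree of c than v.
    twoClaws-obstructedParent : ∀ {v z} → Deg≥3 c → Deg≥3 v → Deg≥3 z → depth v ≡ 2 →
                                z ≢ parent v → ¬ parent v ~ z → TwoDisjointClaws G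
    twoClaws-obstructedParent {v} {z} hc hv hz dv z≢m m≁z = byDepth (depth z) refl
      where
        m = parent v
        dm = depth-parent-pred dv
        ancestor₁-v : ancestor 1 v ≡ m
        ancestor₁-v = ancestor₁-depth₂ dv
        byDepth : ∀ d → depth z ≡ d → TwoDisjointClaws G
        byDepth zero dz = ⊥-elim (m≁z (subst (m ~_) (sym (depth≡0⇒root dz)) (~-sym (depth₁⇒root-~ dm))))
        byDepth (suc zero) dz = twoClaws-differentSubtrees hz hv (≤-reflexive (sym dz)) (m≡2+n⇒2≤m dv)
          λ e → z≢m (trans (sym (ancestor-self z dz)) (trans e ancestor₁-v))
        byDepth (suc (suc zero)) dz =
          twoClaws-differentSubtrees hz hv (≤-trans (s≤s z≤n) (m≡2+n⇒2≤m dz)) (m≡2+n⇒2≤m dv) λ e →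
            m≁z (subst (_~ z) (trans (sym (ancestor₁-depth₂ dz)) (trans e ancestor₁-v))
                              (parent-~ (depth≡suc⇒≢root dz)))
        byDepth (suc (suc (suc _))) dz = twoClaws-rootAndFar hc hz (m≡3+n⇒3≤m dz)

    twoClaws-deg≥4Root : Deg≥4 c → Obstruction c → TwoDisjointClaws G
    twoClaws-deg≥4Root hc (v , inj₁ (c~v , hv))       = twoClaws-adjacentDeg≥4 c~v hc hv
    twoClaws-deg≥4Root hc (v , inj₂ (v≢c , c≁v , hv)) =
      twoClaws-rootAndDeep (deg≥4-avoiding hc _) hv (nonNeighbour-depth v≢c c≁v)

    twoClaws-deg≥3Root : (∀ r → Obstruction r) → (∀ r → ¬ Deg≥4 r) → Deg≥3 c → TwoDisjointClaws G
    twoClaws-deg≥3Root obstructed noDeg≥4 hc with obstructed c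
    ... | v , inj₁ (_ , hv) = ⊥-elim (noDeg≥4 v hv)
    ... | v , inj₂ (v≢c , c≁v , hv) with depth v ≟ⁿ 2 | obstructed (parent v)
    ...   | no dv≢2 | _ = twoClaws-rootAndFar hc hv (≤∧≢⇒< (nonNeighbour-depth v≢c c≁v) (≢-sym dv≢2))
    ...   | yes _   | z , inj₁ (_ , hz) = ⊥-elim (noDeg≥4 z hz)
    ...   | yes dv  | z , inj₂ (z≢m , m≁z , hz) = twoClaws-obstructedParent hc hv hz dv z≢m m≁z

  everyRootObstructed : ¬ InT1 G → ∀ r → Obstruction r
  everyRootObstructed notT1 r with obstruction? r
  ... | yes ob = ob
  ... | no ¬ob = ⊥-elim (notT1 (Rooted.unobstructed⇒InT1 r ¬ob))

  twoClaws : ¬ InT1 G → Fin n → TwoDisjointClaws G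
  twoClaws notT1 r with any? deg≥4?
  ... | yes (c , hc) = Rooted.twoClaws-deg≥4Root c hc (everyRootObstructed notT1 c)
  ... | no ¬deg≥4 with any? deg≥3?
  ...   | yes (u , hu) = Rooted.twoClaws-deg≥3Root u (everyRootObstructed notT1) (λ v hv → ¬deg≥4 (v , hv)) hu
  ...   | no ¬deg≥3 with everyRootObstructed notT1 r
  ...     | v , inj₁ (_ , hv)     = ⊥-elim (¬deg≥4 (v , hv))
  ...     | v , inj₂ (_ , _ , hv) = ⊥-elim (¬deg≥3 (v , hv))

lemma4p1 : (G : Graph) → IsTree G → ¬ InT1 G →
    Σ (Claw G) λ C → Σ (Claw G) λ D → VertexDisjoint G C D
lemma4p1 G (nonempty , connected , acyclic) notT1 = Tree.twoClaws G connected acyclic notT1 (fromℕ< nonempty)
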